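{- Let $U$ be a union-by-size union-find structure and $S$ a sequence of query vertices, and suppose $\textsc{Bulk-Find}(U,S)$ is invoked. Then there is a sequence $S'$ that is a permutation of $S$ such that applying the sequential operation $U.\mathrm{find}$ with full path compression to the elements of $S'$ serially, in that order, starting from the same initial forest, yields the same union-find forest as $\textsc{Bulk-Find}(U,S)$ produces and incurs the same traversal cost $O(|R_\cup|)$, where $R_\cup$ is the sequence of pairs recorded in Phase I of $\textsc{Bulk-Find}$.
   Context: Union-find structure $U$: array $\mathrm{parent}$; $v$ is a root iff $\mathrm{parent}[v]=v$; trees maintained by union by size. The sequential $U.\mathrm{find}(u)$ with full path compression follows parent pointers from $u$ to the root $r$, then sets $\mathrm{parent}[w]=r$ for every node $w$ on the traversed path, and returns $r$; its traversal cost is the number of edges traversed. $\mathrm{removeDup}$ removes duplicates from a sequence (keeping one copy of each element). $\textsc{mkFrontier}(R,\mathit{visited})$: return $\mathrm{removeDup}(\langle v : (v,\_)\in R,\ v\notin\mathit{visited}\rangle)$. $\mathit{RD}.\textsc{allFrom}(f)$ for a sequence of pairs $R_\cup=\langle(\mathit{from}_i,\mathit{to}_i)\rangle$ returns all $\mathit{to}_i$ with $\mathit{from}_i=f$. $\textsc{Bulk-Find}(U,S)$. Phase I: $R_0=\langle (S[k],\mathrm{null}) : k\rangle$; $\mathit{visited}=\emptyset$, $\mathit{roots}=\emptyset$; $F_0=\textsc{mkFrontier}(R_0,\emptyset)$; $i=0$. While $R_i\neq\emptyset$: $\mathit{visited}\gets\mathit{visited}\cup F_i$; $R_{i+1}=\langle(\mathrm{parent}[v],v):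 v\in F_i,\ \mathrm{parent}[v]\neq v\rangle$; $\mathit{roots}\gets\mathit{roots}\cup\{v\in F_i:\mathrm{parent}[v]=v\}$; $F_{i+1}=\textsc{mkFrontier}(R_{i+1},\mathit{visited})$; $i\gets i+1$. Let $R_\cup=R_0\oplus\dots\oplus R_i$ (concatenation). Phase II: $D_0=\{(r,r):r\in\mathit{roots}\}$, $i=0$. While $D_i\neq\emptyset$: in parallel for each $(v,r)\in D_i$ set $\mathrm{parent}[v]\gets r$; $D_{i+1}=\bigcup_{(v,r)\in D_i}\{(u,r): u\in\mathit{RD}.\textsc{allFrom}(v),\ u\neq\mathrm{null}\}$; $i\gets i+1$. Finally return $\mathit{res}$ with $\mathit{res}[k]=\mathrm{parent}[S[k]]$. -}

module Defs where

open import Data.Nat using (ℕ; zero; suc; _+_; _<_; _≤_)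
open import Data.Nat.Properties using (_<?_)
open import Data.Fin using (Fin; _≟_)
open import Data.Bool using (if_then_else_)
open import Data.List using (List; []; _∷_; _++_; map; filter; deduplicate; concatMap; mapMaybe)
open import Data.List.Relation.Unary.Any using (any?)
open import Data.Maybe using (Maybe; just; nothing)
open import Data.Product using (_×_; _,_; proj₁)
open import Function using (id)
open import Relation.Nullary using (¬_; ¬?; does)
open import Relation.Binary.PropositionalEquality using (_≡_; _≢_)

Parent : ℕ → Set
Parent n = Fin n → Fin n

_[_↦_] : ∀ {n} {A : Set} → (Fin n → A) → Fin n → A → (Fin n → A)
(p [ u ↦ r ]) v = if does (v ≟ u) then r else p v

-- Find p u r p' c : starting from forest p, find(u) returns root r,
-- leaves forest p' (every node on the traversed path now points to r),
-- and traverses c parent edges.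
data Find {n} (p : Parent n) : Fin n → Fin n → Parent n → ℕ → Set where
  atRoot : ∀ {u} → p u ≡ u → Find p u u p 0
  step   : ∀ {u r p' c} → p u ≢ u → Find p (p u) r p' c →
           Find p u r (p' [ u ↦ r ]) (suc c)

data FindSeq {n} : Parent n → List (Fin n) → Parent n → ℕ → Set where
  []  : ∀ {p} → FindSeq p [] p 0
  _∷_ : ∀ {p u r p₁ c₁ us p₂ c₂} → Find p u r p₁ c₁ → FindSeq p₁ us p₂ c₂ →
        FindSeq p (u ∷ us) p₂ (c₁ + c₂)

-- Union-by-size union-find structures: exactly the (parent, size) states
-- reachable from n singletons by union-by-size unions (with path-compressing
-- finds of both arguments) and path-compressing finds.
data UBS {n} : Parent n → (Fin n → ℕ) → Set where
  init      : UBS (λ v → v) (λ _ → 1)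
  find      : ∀ {p s x r p' c} → UBS p s → Find p x r p' c → UBS p' s
  unionSame : ∀ {p s x y r p₁ c₁ p₂ c₂} → UBS p s →
              Find p x r p₁ c₁ → Find p₁ y r p₂ c₂ → UBS p₂ s
  unionLt   : ∀ {p s x y rx ry p₁ c₁ p₂ c₂} → UBS p s →
              Find p x rx p₁ c₁ → Find p₁ y ry p₂ c₂ → rx ≢ ry →
              s rx < s ry →
              UBS (p₂ [ rx ↦ ry ]) (s [ ry ↦ s rx + s ry ])
  unionGe   : ∀ {p s x y rx ry p₁ c₁ p₂ c₂} → UBS p s →
              Find p x rx p₁ c₁ → Find p₁ y ry p₂ c₂ → rx ≢ ry →
              s ry ≤ s rx →
              UBS (p₂ [ ry ↦ rx ]) (s [ rx ↦ s rx + s ry ])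

-- Bulk-Find.  Pairs (from, to) with to = nothing representing null.
Pair : ℕ → Set
Pair n = Fin n × Maybe (Fin n)

removeDup : ∀ {n} → List (Fin n) → List (Fin n)
removeDup = deduplicate _≟_

mkFrontier : ∀ {n} → List (Pair n) → List (Fin n) → List (Fin n)
mkFrontier R visited =
  removeDup (filter (λ v → ¬? (any? (λ w → v ≟ w) visited)) (map proj₁ R))

nextR : ∀ {n} → Parent n → List (Fin n) → List (Pair n)
nextR p F = map (λ v → (p v , just v)) (filter (λ v → ¬? (p v ≟ v)) F)

rootsOf : ∀ {n} → Parent n → List (Fin n) → List (Fin n)
rootsOf p F = filter (λ v → p v ≟ v) F

-- Phase1 p R F visited roots acc Rcup roots'
-- : running the while-loop from state (R_i = R, F_i = F, visited, roots),
-- with acc = R_0 ⊕ … ⊕ R_i, terminates with R_∪ = Rcup and roots = roots'.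
data Phase1 {n} (p : Parent n) :
     List (Pair n) → List (Fin n) → List (Fin n) → List (Fin n) →
     List (Pair n) → List (Pair n) → List (Fin n) → Set where
  done : ∀ {F vis roots acc} → Phase1 p [] F vis roots acc acc roots
  loop : ∀ {x R F vis roots acc Rcup roots'} →
         Phase1 p (nextR p F) (mkFrontier (nextR p F) (vis ++ F))
                (vis ++ F) (roots ++ rootsOf p F) (acc ++ nextR p F)
                Rcup roots' →
         Phase1 p (x ∷ R) F vis roots acc Rcup roots'

allFrom : ∀ {n} → List (Pair n) → Fin n → List (Maybe (Fin n))
allFrom Rcup f =
  map (λ e → Data.Product.proj₂ e) (filter (λ e → proj₁ e ≟ f) Rcup)

-- the "in parallel" writes parent[v] ← r for (v,r) ∈ D
applyWrites : ∀ {n} → Parent n → List (Fin n × Fin n) → Parent n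
applyWrites p []            = p
applyWrites p ((v , r) ∷ D) = applyWrites (p [ v ↦ r ]) D

nextD : ∀ {n} → List (Pair n) → List (Fin n × Fin n) → List (Fin n × Fin n)
nextD Rcup D =
  concatMap (λ e → map (λ u → (u , Data.Product.proj₂ e))
                       (mapMaybe id (allFrom Rcup (proj₁ e)))) D

-- Phase II loop: Phase2 Rcup p D p' : from forest p and D_i = D the loop
-- terminates with forest p'.
data Phase2 {n} (Rcup : List (Pair n)) :
     Parent n → List (Fin n × Fin n) → Parent n → Set where
  done : ∀ {p} → Phase2 Rcup p [] p
  loop : ∀ {p d D p'} →
         Phase2 Rcup (applyWrites p (d ∷ D)) (nextD Rcup (d ∷ D)) p' →
         Phase2 Rcup p (d ∷ D) p'

R₀ : ∀ {n} → List (Fin n) → List (Pair n)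
R₀ S = map (λ v → (v , nothing)) S

-- BulkFind p S Rcup p' res : an invocation of Bulk-Find(U,S) on forest p
-- records R_∪ = Rcup in Phase I, leaves forest p', and returns res.
record BulkFind {n} (p : Parent n) (S : List (Fin n))
                (Rcup : List (Pair n)) (p' : Parent n)
                (res : List (Fin n)) : Set where
  field
    roots  : List (Fin n)
    phase1 : Phase1 p (R₀ S) (mkFrontier (R₀ S) []) [] [] (R₀ S) Rcup roots
    phase2 : Phase2 Rcup p (map (λ r → (r , r)) roots) p'
    result : res ≡ map p' S

-- Let A be the set of ancestors of the query nodes. Phase I visits exactly A, recording the
-- pair (parent w, w) for every non-root w ∈ A and collecting the roots in A; Phase II pushes
-- each of these roots down the recorded pairs, so Bulk-Find points every node of A at its root
-- and changes nothing else. Serial finds on S, in the given order, leave the same forest: each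
-- find points its whole path at the root, and every path starts in S. For the cost, an edge
-- w → q w traversed by a serial find either has q w not yet a root, and then w is a recorded
-- node that points at a root from then on, or it is the last edge of that find; so the total
-- is at most |R_∪| + |S| ≤ 2 |R_∪|. Union by size matters only in that the forest is acyclic.

module Submission where

open import Defs
open import Data.Nat using (ℕ; suc; _+_; _*_; _≤_; _<_; s≤s)
open import Data.Fin using (Fin; _≟_)
open import Data.List using (List; []; _∷_; _++_; [_]; length; filter; map; mapMaybe)
open import Data.List.Properties using (++-assoc; ++-identityʳ; length-filter; length-map; length-mapMaybe; length-++; map-∘; map-id)
open import Data.List.Membership.Propositional using (_∈_; _∉_; lose) renaming (find to find-∈)
open import Data.List.Membership.Propositional.Properties using (∈-map⁺; ∈-map⁻; ∈-++⁺ˡ; ∈-++⁺ʳ; ∈-++⁻; ∈-filter⁺; ∈-filter⁻; ∈-concatMap⁺; ∈-concatMap⁻; ∈-deduplicate⁺; ∈-deduplicate⁻)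
open import Data.List.Relation.Unary.Any as Any using (Any; here; there)
open import Data.List.Relation.Unary.Any.Properties using (++⁺ˡ; ++⁺ʳ; ++⁻; map⁺; mapMaybe⁺)
open import Data.Maybe using (Maybe; just; nothing)
import Data.Maybe.Relation.Unary.Any as Maybe
open import Data.List.Relation.Binary.Sublist.Propositional using (⊆-refl)
open import Data.List.Relation.Binary.Sublist.Propositional.Properties using (filter⁺; length-mono-≤)
open import Data.Nat.Properties using (+-identityʳ; +-assoc; +-comm; +-suc; +-monoˡ-≤; +-monoʳ-≤; +-mono-≤; m≤m+n; ≤-refl; ≤-trans; ≤-reflexive; m<n⇒m<1+n; module ≤-Reasoning)
open import Relation.Unary using (Decidable)
open import Data.Product using (∃; ∃₂; ∃-syntax; _×_; _,_; proj₁; proj₂; map₁; map₂)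
open import Data.List.Relation.Binary.Permutation.Propositional using (_↭_; ↭-refl)
open import Data.Sum using (_⊎_; inj₁; inj₂)
open import Data.Empty using (⊥-elim)
open import Function using (_∘_; id)
open import Relation.Nullary using (¬_; ¬?; yes; no; contradiction)
open import Relation.Nullary.Decidable using (dec-true; dec-false)
open import Relation.Binary.PropositionalEquality using (_≡_; _≢_; refl; sym; trans; subst; cong)
open import Relation.Binary.Construct.Closure.ReflexiveTransitive using (Star; ε; _◅_; _◅◅_)

private variable
  n : ℕ
  A : Set
  u v w x r r′ : Fin n
  p q : Parent n
  V : List (Fin n)

module _ {P Q : A → Set} (P? : Decidable P) (Q? : Decidable Q) (P⇒Q : ∀ {x} → P x → Q x) where

  length-filter-mono : ∀ xs → length (filter P? xs) ≤ length (filter Q? xs)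
  length-filter-mono xs = length-mono-≤ (filter⁺ P? Q? (λ { refl → P⇒Q }) (⊆-refl {x = xs}))

  length-filter-< : ∀ {x xs} → x ∈ xs → ¬ P x → Q x → length (filter P? xs) < length (filter Q? xs)
  length-filter-< {xs = y ∷ ys} (here refl) ¬Py Qy with P? y | Q? y
  ... | yes Py | _ = contradiction Py ¬Py
  ... | no _ | yes _ = s≤s (length-filter-mono ys)
  ... | no _ | no ¬Qy = contradiction Qy ¬Qy
  length-filter-< {xs = y ∷ ys} (there x∈ys) ¬Px Qx with P? y | Q? y
  ... | yes _ | yes _ = s≤s (length-filter-< x∈ys ¬Px Qx)
  ... | yes Py | no ¬Qy = contradiction (P⇒Q Py) ¬Qy
  ... | no _ | yes _ = m<n⇒m<1+n (length-filter-< x∈ys ¬Px Qx)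
  ... | no _ | no _ = length-filter-< x∈ys ¬Px Qx

module _ {B : Set} (f : A → Maybe B) where

  ∈-mapMaybe⁺ : ∀ {x y xs} → x ∈ xs → f x ≡ just y → y ∈ mapMaybe f xs
  ∈-mapMaybe⁺ {xs = xs} x∈xs fx≡y =
    mapMaybe⁺ f xs (map⁺ (lose x∈xs (subst (Maybe.Any (_ ≡_)) (sym fx≡y) (Maybe.just refl))))

  ∈-mapMaybe⁻ : ∀ xs {y} → y ∈ mapMaybe f xs → ∃ λ x → x ∈ xs × f x ≡ just y
  ∈-mapMaybe⁻ (x ∷ xs) y∈ with f x in fx≡ | y∈
  ... | nothing | y∈′ = map₂ (map₁ there) (∈-mapMaybe⁻ xs y∈′)
  ... | just _ | here refl = x , here refl , fx≡
  ... | just _ | there y∈′ = map₂ (map₁ there) (∈-mapMaybe⁻ xs y∈′)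

module _ (f : Fin n → A) {u : Fin n} {a : A} where

  [↦]-same : (f [ u ↦ a ]) u ≡ a
  [↦]-same rewrite dec-true (u ≟ u) refl = refl

  [↦]-other : w ≢ u → (f [ u ↦ a ]) w ≡ f w
  [↦]-other {w} w≢u rewrite dec-false (w ≟ u) w≢u = refl

-- Forests, roots and compression

IsRoot : Parent n → Fin n → Set
IsRoot p u = p u ≡ u

Edge : Parent n → Fin n → Fin n → Set
Edge p u v = p u ≢ u × p u ≡ v

Path : Parent n → Fin n → Fin n → Set
Path p = Star (Edge p)

Root : Parent n → Fin n → Fin n → Set
Root p u r = Path p u r × IsRoot p r

Total : Parent n → Set
Total p = ∀ u → ∃ (Root p u)

module _ {p : Parent n} where

  path-to-parent : ∀ u → Path p u (p u)
  path-to-parent u with p u ≟ u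
  ... | yes u-root = subst (Path p u) (sym u-root) ε
  ... | no u≢pu = (u≢pu , refl) ◅ ε

  unstep : Path p u w → u ≡ w ⊎ (p u ≢ u × Path p (p u) w)
  unstep ε = inj₁ refl
  unstep ((pu≢u , refl) ◅ P) = inj₂ (pu≢u , P)

  path-from-root : IsRoot p u → Path p u w → w ≡ u
  path-from-root _ ε = refl
  path-from-root u-root ((pu≢u , _) ◅ _) = ⊥-elim (pu≢u u-root)

  root-unique : Root p u r → Root p u r′ → r ≡ r′
  root-unique (ε , u-root) (P , _) = sym (path-from-root u-root P)
  root-unique ((pu≢u , refl) ◅ _ , _) (ε , u-root) = ⊥-elim (pu≢u u-root)
  root-unique ((_ , refl) ◅ P , r-root) ((_ , refl) ◅ P′ , r′-root) =
    root-unique (P , r-root) (P′ , r′-root)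

  root-upward : Path p u w → Root p u r → Root p w r
  root-upward ε ρ = ρ
  root-upward ((pu≢u , refl) ◅ _) (ε , u-root) = ⊥-elim (pu≢u u-root)
  root-upward ((_ , refl) ◅ P) ((_ , refl) ◅ Q , r-root) = root-upward P (Q , r-root)

  no-return : Path p u r → IsRoot p r → p u ≢ u → ¬ Path p (p u) u
  no-return ε r-root pu≢u _ = pu≢u r-root
  no-return ((_ , refl) ◅ R) r-root pu≢u C with unstep C
  ... | inj₁ pu≡u = pu≢u pu≡u
  ... | inj₂ (ppu≢pu , C′) = no-return R r-root ppu≢pu (C′ ◅◅ (pu≢u , refl) ◅ ε)

  path-antisym : Total p → Path p u w → Path p w u → w ≡ u
  path-antisym {u} total P Q with unstep P | total u
  ... | inj₁ u≡w | _ = sym u≡w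
  ... | inj₂ (pu≢u , P′) | _ , R , r-root = ⊥-elim (no-return R r-root pu≢u (P′ ◅◅ Q))

module _ {q : Parent n} where

  find-root : ∀ {q′ c} → Find q u r q′ c → Root q u r
  find-root (atRoot u-root) = ε , u-root
  find-root (step qu≢u F) = map₁ ((qu≢u , refl) ◅_) (find-root F)

  find-exists : Root q u r → ∃₂ (Find q u r)
  find-exists (ε , r-root) = _ , _ , atRoot r-root
  find-exists ((qu≢u , refl) ◅ P , r-root) =
    let _ , _ , F = find-exists (P , r-root) in _ , _ , step qu≢u F

  find-writes : ∀ {q′ c} → Find q u r q′ c → ∀ w → q′ w ≡ q w ⊎ (Path q u w × q′ w ≡ r)
  find-writes (atRoot _) w = inj₁ refl
  find-writes {u} (step qu≢u F) w with w ≟ u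
  ... | yes refl = inj₂ (ε , refl)
  ... | no _ with find-writes F w
  ...   | inj₁ q′w≡qw = inj₁ q′w≡qw
  ...   | inj₂ (P , q′w≡r) = inj₂ ((qu≢u , refl) ◅ P , q′w≡r)

Compression : Parent n → Parent n → Set
Compression p q = ∀ w → q w ≡ p w ⊎ Root p w (q w)

compression-refl : Compression p p
compression-refl _ = inj₁ refl

module _ {p q : Parent n} (cq : Compression p q) where

  compression-edge : ∀ w → Path p w (q w)
  compression-edge w with cq w
  ... | inj₁ qw≡pw = subst (Path p w) (sym qw≡pw) (path-to-parent w)
  ... | inj₂ (P , _) = P

  compression-path : Path q u w → Path p u w
  compression-path ε = ε
  compression-path {u} ((_ , refl) ◅ P) = compression-edge u ◅◅ compression-path P

  compression-isRoot⁺ : IsRoot p w → IsRoot q w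
  compression-isRoot⁺ {w} w-root with cq w
  ... | inj₁ qw≡pw = trans qw≡pw w-root
  ... | inj₂ (P , _) = path-from-root w-root P

  compression-isRoot⁻ : IsRoot q w → IsRoot p w
  compression-isRoot⁻ {w} w-root with cq w
  ... | inj₁ qw≡pw = trans (sym qw≡pw) w-root
  ... | inj₂ (_ , qw-root) = subst (IsRoot p) w-root qw-root

  compression-at-root : IsRoot p r → Root p r (q r)
  compression-at-root r-root = subst (Root p _) (sym (compression-isRoot⁺ r-root)) (ε , r-root)

  compression-root⁻ : Root q u r → Root p u r
  compression-root⁻ (P , r-root) = compression-path P , compression-isRoot⁻ r-root

  compression-root⁺ : Path p u r → IsRoot p r → Root q u r
  compression-root⁺ ε r-root = ε , compression-isRoot⁺ r-root
  compression-root⁺ {u} P@((pu≢u , refl) ◅ P′) r-root with cq u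
  ... | inj₁ qu≡pu = map₁ ((qu≢u , qu≡pu) ◅_) (compression-root⁺ P′ r-root)
    where qu≢u = pu≢u ∘ compression-isRoot⁻
  ... | inj₂ ρ = (pu≢u ∘ compression-isRoot⁻ , root-unique ρ (P , r-root)) ◅ ε ,
                 compression-isRoot⁺ r-root

  compression-total : Total p → Total q
  compression-total total u = let r , P , r-root = total u in r , compression-root⁺ P r-root

  find-writes-root : ∀ {q′ c} → Find q u r q′ c → ∀ w → q′ w ≡ q w ⊎ (Path p u w × Root p w (q′ w))
  find-writes-root F w with find-writes F w
  ... | inj₁ q′w≡qw = inj₁ q′w≡qw
  ... | inj₂ (P , q′w≡r) =
    inj₂ (compression-path P ,
          subst (Root p w) (sym q′w≡r) (root-upward (compression-path P) (compression-root⁻ (find-root F))))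

  find-compression : ∀ {q′ c} → Find q u r q′ c → Compression p q′
  find-compression F w with find-writes-root F w
  ... | inj₁ q′w≡qw = subst (λ z → z ≡ p w ⊎ Root p w z) (sym q′w≡qw) (cq w)
  ... | inj₂ (_ , ρ) = inj₂ ρ

module _ {q : Parent n} {q′ : Parent n} {c : ℕ} (F : Find q u r q′ c) where

  find-total : Total q → Total q′
  find-total = compression-total (find-compression compression-refl F)

  find-isRoot : IsRoot q′ r
  find-isRoot = compression-isRoot⁺ (find-compression compression-refl F) (proj₂ (find-root F))

  find-preserves-isRoot : IsRoot q w → IsRoot q′ w
  find-preserves-isRoot = compression-isRoot⁺ (find-compression compression-refl F)

module _ {q : Parent n} {a b : Fin n} (a-root : IsRoot q a) where

  link-path : Path q u w → Path (q [ a ↦ b ]) u w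
  link-path ε = ε
  link-path {u} ((qu≢u , refl) ◅ P) = (qu≢u ∘ trans (sym q′u≡qu) , q′u≡qu) ◅ link-path P
    where
    u≢a : u ≢ a
    u≢a refl = qu≢u a-root
    q′u≡qu = [↦]-other q u≢a

  link-total : IsRoot q b → a ≢ b → Total q → Total (q [ a ↦ b ])
  link-total b-root a≢b total w with total w
  ... | r , P , r-root with r ≟ a
  ...   | yes refl = b , link-path P ◅◅ (a≢b ∘ sym ∘ trans (sym ([↦]-same q)) , [↦]-same q) ◅ ε ,
                     trans ([↦]-other q (a≢b ∘ sym)) b-root
  ...   | no r≢a = r , link-path P , trans ([↦]-other q r≢a) r-root

UBS⇒Total : ∀ {p : Parent n} {s} → UBS p s → Total p
UBS⇒Total init w = w , ε , refl
UBS⇒Total (find U F) = find-total F (UBS⇒Total U)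
UBS⇒Total (unionSame U F₁ F₂) = find-total F₂ (find-total F₁ (UBS⇒Total U))
UBS⇒Total (unionLt U F₁ F₂ rx≢ry _) =
  link-total (find-preserves-isRoot F₂ (find-isRoot F₁)) (find-isRoot F₂) rx≢ry
             (find-total F₂ (find-total F₁ (UBS⇒Total U)))
UBS⇒Total (unionGe U F₁ F₂ rx≢ry _) =
  link-total (find-isRoot F₂) (find-preserves-isRoot F₂ (find-isRoot F₁)) (rx≢ry ∘ sym)
             (find-total F₂ (find-total F₁ (UBS⇒Total U)))

-- Serial finds

Ancestor : Parent n → List (Fin n) → Fin n → Set
Ancestor p V w = Any (λ s → Path p s w) V

record PathCompressed (p : Parent n) (V : List (Fin n)) (q : Parent n) : Set where
  field
    sound    : ∀ w → q w ≡ p w ⊎ (Root p w (q w) × Ancestor p V w)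
    complete : ∀ {w} → Ancestor p V w → Root p w (q w)

  compression : Compression p q
  compression w with sound w
  ... | inj₁ qw≡pw = inj₁ qw≡pw
  ... | inj₂ (ρ , _) = inj₂ ρ

  upward-closed : Root p w (q w) → Path p w x → Root p x (q x)
  upward-closed {w} ρ P with sound w
  ... | inj₂ (_ , a) = complete (Any.map (_◅◅ P) a)
  ... | inj₁ qw≡pw with unstep P
  ...   | inj₁ refl = ρ
  ...   | inj₂ (_ , P′) =
    subst (λ y → Root p y (q y)) (sym (path-from-root pw-root P′))
          (compression-at-root compression pw-root)
    where pw-root = subst (IsRoot p) qw≡pw (proj₂ ρ)

open PathCompressed

pathCompressed-unique : ∀ {q′} → PathCompressed p V q → PathCompressed p V q′ → ∀ w → q w ≡ q′ w
pathCompressed-unique pc pc′ w with sound pc w | sound pc′ w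
... | inj₁ qw≡pw | inj₁ q′w≡pw = trans qw≡pw (sym q′w≡pw)
... | inj₁ _ | inj₂ (ρ′ , a) = root-unique (complete pc a) ρ′
... | inj₂ (ρ , a) | _ = root-unique ρ (complete pc′ a)

pathCompressed-[] : PathCompressed p [] p
pathCompressed-[] = record { sound = λ _ → inj₁ refl ; complete = λ () }

module _ {p q : Parent n} {V : List (Fin n)} (pc : PathCompressed p V q) where

  private cq = compression pc

  find-preserves-root : ∀ {q′ c} → Find q u r q′ c → Root p w (q w) → Root p w (q′ w)
  find-preserves-root {w = w} F ρ with find-writes-root cq F w
  ... | inj₁ q′w≡qw = subst (Root p w) (sym q′w≡qw) ρ
  ... | inj₂ (_ , ρ′) = ρ′

  find-compresses : ∀ {q′ c} → Find q u r q′ c → Path p u w → Root p w (q′ w)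
  find-compresses (atRoot u-root) P =
    subst (λ y → Root p y (q y)) (sym (path-from-root pu≡u P)) (compression-at-root cq pu≡u)
    where pu≡u = compression-isRoot⁻ cq u-root
  find-compresses {u} {w = w} F@(step _ F₁) P with w ≟ u
  ... | yes refl = compression-root⁻ cq (find-root F)
  ... | no w≢u with unstep P
  ...   | inj₁ u≡w = contradiction (sym u≡w) w≢u
  ...   | inj₂ (_ , P′) with sound pc u
  ...     | inj₁ qu≡pu = find-compresses F₁ (subst (λ z → Path p z w) (sym qu≡pu) P′)
  ...     | inj₂ (ρ , _) = find-preserves-root F₁ (upward-closed pc ρ P)

  find-pathCompressed : ∀ {q′ c} → Find q u r q′ c → PathCompressed p (V ++ [ u ]) q′
  find-pathCompressed {u} {q′ = q′} F = record { sound = sound′ ; complete = complete′ }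
    where
    sound′ : ∀ w → q′ w ≡ p w ⊎ (Root p w (q′ w) × Ancestor p (V ++ [ u ]) w)
    sound′ w with find-writes-root cq F w | sound pc w
    ... | inj₂ (P , ρ) | _ = inj₂ (ρ , ++⁺ʳ V (here P))
    ... | inj₁ q′w≡qw | inj₁ qw≡pw = inj₁ (trans q′w≡qw qw≡pw)
    ... | inj₁ q′w≡qw | inj₂ (ρ , a) = inj₂ (subst (Root p w) (sym q′w≡qw) ρ , ++⁺ˡ a)

    complete′ : ∀ {w} → Ancestor p (V ++ [ u ]) w → Root p w (q′ w)
    complete′ a with ++⁻ V a
    ... | inj₁ a′ = find-preserves-root F (complete pc a′)
    ... | inj₂ (here P) = find-compresses F P

Unsettled : Parent n → Parent n → Fin n → Set
Unsettled p q w = p (q w) ≢ q w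

unsettled? : (p q : Parent n) → Decidable (Unsettled p q)
unsettled? p q w = ¬? (p (q w) ≟ q w)

-- A find pays for every edge it traverses out of a node counted here by re-pointing that node
-- at its root; only the last edge of each find goes unpaid.
potential : Parent n → List (Fin n) → Parent n → ℕ
potential p L q = length (filter (unsettled? p q) L)

module _ (p q : Parent n) {r : Fin n} (r-root : IsRoot p r) where

  unsettled-[↦]⁻ : Unsettled p (q [ u ↦ r ]) w → Unsettled p q w
  unsettled-[↦]⁻ {u} {w} unsettled with w ≟ u
  ... | yes refl = contradiction r-root unsettled
  ... | no _ = unsettled

  settled-[↦] : ∀ u → ¬ Unsettled p (q [ u ↦ r ]) u
  settled-[↦] _ unsettled = unsettled (subst (IsRoot p) (sym ([↦]-same q)) r-root)

module _ {p : Parent n} (total : Total p) {L : List (Fin n)} where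

  private Φ = potential p L

  find-cost : ∀ {q′ c} → Compression p q → (∀ {w} → Path p u w → p w ≢ w → w ∈ L) →
              Find q u r q′ c → c + Φ q′ ≤ Φ q + 1
  find-cost _ _ (atRoot _) = m≤m+n _ 1
  find-cost {q = q} cq _ (step {u} _ (atRoot qqu≡qu)) = begin
    suc (Φ (q [ u ↦ q u ]))  ≡⟨ +-comm 1 _ ⟩
    Φ (q [ u ↦ q u ]) + 1    ≤⟨ +-monoˡ-≤ 1 (length-filter-mono (unsettled? p _) (unsettled? p q)
                                  (unsettled-[↦]⁻ p q (compression-isRoot⁻ cq qqu≡qu)) L) ⟩
    Φ q + 1                  ∎
    where open ≤-Reasoning
  find-cost {q = q} cq inL (step {u} {r} qu≢u F₁@(step {p' = q₂} {c = c₂} qqu≢qu _)) = begin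
    suc (suc c₂) + Φ q′    ≡⟨ sym (+-suc (suc c₂) _) ⟩
    suc c₂ + suc (Φ q′)    ≤⟨ +-monoʳ-≤ (suc c₂) u-settles ⟩
    suc c₂ + Φ q₁          ≤⟨ find-cost cq (λ P → inL (compression-edge cq u ◅◅ P)) F₁ ⟩
    Φ q + 1                ∎
    where
    open ≤-Reasoning
    q₁ = q₂ [ q u ↦ r ]
    q′ = q₁ [ u ↦ r ]
    r-root = proj₂ (compression-root⁻ cq (find-root F₁))

    q₁u≡qu : q₁ u ≡ q u
    q₁u≡qu with find-writes F₁ u
    ... | inj₁ q₁u≡qu = q₁u≡qu
    ... | inj₂ (P , _) =
      contradiction (path-antisym total (compression-edge cq u) (compression-path cq P)) qu≢u

    u-unsettled : Unsettled p q₁ u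
    u-unsettled = subst (λ z → p z ≢ z) (sym q₁u≡qu) (qqu≢qu ∘ compression-isRoot⁺ cq)

    u-settles : suc (Φ q′) ≤ Φ q₁
    u-settles = length-filter-< (unsettled? p q′) (unsettled? p q₁) (unsettled-[↦]⁻ p q₁ r-root)
                  (inL ε (qu≢u ∘ compression-isRoot⁺ cq)) (settled-[↦] p q₁ r-root u) u-unsettled

  findSeq-pathCompressed : PathCompressed p V q → (T : List (Fin n)) →
                           (∀ {w} → Ancestor p T w → p w ≢ w → w ∈ L) →
                           ∃₂ λ q″ c → FindSeq q T q″ c × PathCompressed p (V ++ T) q″ ×
                                       c + Φ q″ ≤ Φ q + length T
  findSeq-pathCompressed {V = V} {q = q} pc [] _ =
    q , 0 , [] , subst (λ V′ → PathCompressed p V′ q) (sym (++-identityʳ V)) pc ,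
    ≤-reflexive (sym (+-identityʳ _))
  findSeq-pathCompressed {V = V} {q = q} pc (t ∷ T) inL
    with find-exists (proj₂ (compression-total (compression pc) total t))
  ... | q₁ , c₁ , F with findSeq-pathCompressed (find-pathCompressed pc F) T (inL ∘ there)
  ...   | q″ , c₂ , Fs , pc″ , cost =
    q″ , c₁ + c₂ , F ∷ Fs , subst (λ V′ → PathCompressed p V′ q″) (++-assoc V [ t ] T) pc″ , (begin
      (c₁ + c₂) + Φ q″        ≡⟨ +-assoc c₁ c₂ _ ⟩
      c₁ + (c₂ + Φ q″)        ≤⟨ +-monoʳ-≤ c₁ cost ⟩
      c₁ + (Φ q₁ + length T)  ≡⟨ sym (+-assoc c₁ _ _) ⟩
      (c₁ + Φ q₁) + length T  ≤⟨ +-monoˡ-≤ (length T) (find-cost (compression pc) (inL ∘ here) F) ⟩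
      (Φ q + 1) + length T    ≡⟨ +-assoc (Φ q) 1 _ ⟩
      Φ q + suc (length T)    ∎)
    where open ≤-Reasoning

-- Phase I of Bulk-Find

module _ (R : List (Pair n)) (vis : List (Fin n)) where

  ∈-mkFrontier⁻ : v ∈ mkFrontier R vis → v ∈ map proj₁ R × v ∉ vis
  ∈-mkFrontier⁻ v∈ = ∈-filter⁻ (λ v → ¬? (Any.any? (v ≟_) vis)) (∈-deduplicate⁻ _≟_ _ v∈)

  ∈-mkFrontier⁺ : v ∈ map proj₁ R → v ∉ vis → v ∈ mkFrontier R vis
  ∈-mkFrontier⁺ v∈ v∉ = ∈-deduplicate⁺ _≟_ (∈-filter⁺ (λ v → ¬? (Any.any? (v ≟_) vis)) v∈ v∉)

module _ (p : Parent n) (F : List (Fin n)) where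

  ∈-nextR⁺ : v ∈ F → p v ≢ v → (p v , just v) ∈ nextR p F
  ∈-nextR⁺ v∈F pv≢v = ∈-map⁺ (λ v → (p v , just v)) (∈-filter⁺ (λ v → ¬? (p v ≟ v)) v∈F pv≢v)

  ∈-nextR⁻ : ∀ {e} → e ∈ nextR p F → ∃ λ v → v ∈ F × p v ≢ v × e ≡ (p v , just v)
  ∈-nextR⁻ e∈ with ∈-map⁻ (λ v → (p v , just v)) e∈
  ... | v , v∈ , refl = let v∈F , pv≢v = ∈-filter⁻ (λ v → ¬? (p v ≟ v)) v∈ in v , v∈F , pv≢v , refl

phase1-length : ∀ {R F vis roots acc Rcup roots′} → Phase1 p R F vis roots acc Rcup roots′ →
                length acc ≤ length Rcup
phase1-length done = ≤-refl
phase1-length {acc = acc} (loop run) =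
  ≤-trans (subst (length acc ≤_) (sym (length-++ acc)) (m≤m+n _ _)) (phase1-length run)

ValidEdges : Parent n → List (Fin n) → List (Pair n) → Set
ValidEdges p S R = ∀ {a b} → (a , just b) ∈ R → Edge p b a × Ancestor p S b

ValidRoots : Parent n → List (Fin n) → List (Fin n) → Set
ValidRoots p S rs = ∀ {r} → r ∈ rs → IsRoot p r × Ancestor p S r

Recorded : Parent n → List (Pair n) → List (Fin n) → Fin n → Set
Recorded p R rs w = (IsRoot p w → w ∈ rs) × (p w ≢ w → (p w , just w) ∈ R)

Explored : Parent n → List (Fin n) → List (Fin n) → List (Pair n) → List (Fin n) → Set
Explored p vis roots acc F = ∀ {w} → w ∈ vis → Recorded p acc roots w × (p w ≢ w → p w ∈ vis ++ F)

module _ {p : Parent n} {S : List (Fin n)} where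

  phase1-sound : ∀ {R F vis roots acc Rcup roots′} → Phase1 p R F vis roots acc Rcup roots′ →
                 ValidEdges p S acc → ValidRoots p S roots → (∀ {v} → v ∈ F → Ancestor p S v) →
                 ValidEdges p S Rcup × ValidRoots p S roots′
  phase1-sound done edges rts _ = edges , rts
  phase1-sound {F = F} {vis} {roots} {acc} (loop run) edges rts front = phase1-sound run edges′ rts′ front′
    where
    edges′ : ValidEdges p S (acc ++ nextR p F)
    edges′ e∈ with ∈-++⁻ acc e∈
    ... | inj₁ e∈acc = edges e∈acc
    ... | inj₂ e∈new with ∈-nextR⁻ p F e∈new
    ...   | _ , v∈F , pv≢v , refl = (pv≢v , refl) , front v∈F

    rts′ : ValidRoots p S (roots ++ rootsOf p F)
    rts′ r∈ with ∈-++⁻ roots r∈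
    ... | inj₁ r∈roots = rts r∈roots
    ... | inj₂ r∈new = let r∈F , r-root = ∈-filter⁻ (λ v → p v ≟ v) r∈new in r-root , front r∈F

    front′ : ∀ {v} → v ∈ mkFrontier (nextR p F) (vis ++ F) → Ancestor p S v
    front′ v∈ with ∈-map⁻ proj₁ (proj₁ (∈-mkFrontier⁻ (nextR p F) (vis ++ F) v∈))
    ... | _ , e∈ , refl with ∈-nextR⁻ p F e∈
    ...   | _ , b∈F , pb≢b , refl = Any.map (_◅◅ (pb≢b , refl) ◅ ε) (front b∈F)

  phase1-complete : ∀ {R F vis roots acc Rcup roots′} → Phase1 p R F vis roots acc Rcup roots′ →
                    Explored p vis roots acc F → (∀ {s} → s ∈ S → s ∈ vis ++ F) →
                    (∀ {v} → v ∈ F → v ∈ map proj₁ R) →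
                    ∀ {w} → Ancestor p S w → Recorded p Rcup roots′ w
  phase1-complete {F = F} {vis} done explored covers frontier a =
    let _ , s∈S , P = find-∈ a in proj₁ (explored (reach (visited (covers s∈S)) P))
    where
    visited : ∀ {x} → x ∈ vis ++ F → x ∈ vis
    visited x∈ with ∈-++⁻ vis x∈
    ... | inj₁ x∈vis = x∈vis
    ... | inj₂ x∈F with () ← frontier x∈F

    reach : ∀ {x y} → x ∈ vis → Path p x y → y ∈ vis
    reach x∈vis ε = x∈vis
    reach x∈vis ((px≢x , refl) ◅ P) = reach (visited (proj₂ (explored x∈vis) px≢x)) P
  phase1-complete {F = F} {vis} {roots} {acc} (loop run) explored covers _ =
    phase1-complete run explored′ (∈-++⁺ˡ ∘ covers) (proj₁ ∘ ∈-mkFrontier⁻ (nextR p F) (vis ++ F))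
    where
    explored′ : Explored p (vis ++ F) (roots ++ rootsOf p F) (acc ++ nextR p F)
                         (mkFrontier (nextR p F) (vis ++ F))
    explored′ {w} w∈ with ∈-++⁻ vis w∈
    ... | inj₁ w∈vis = let (root , edge) , up = explored w∈vis in
                       (∈-++⁺ˡ ∘ root , ∈-++⁺ˡ ∘ edge) , ∈-++⁺ˡ ∘ up
    ... | inj₂ w∈F =
      (∈-++⁺ʳ roots ∘ ∈-filter⁺ (λ v → p v ≟ v) w∈F , ∈-++⁺ʳ acc ∘ ∈-nextR⁺ p F w∈F) , up
      where
      up : p w ≢ w → p w ∈ (vis ++ F) ++ mkFrontier (nextR p F) (vis ++ F)
      up pw≢w with Any.any? (p w ≟_) (vis ++ F)
      ... | yes pw∈ = ∈-++⁺ˡ pw∈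
      ... | no pw∉ = ∈-++⁺ʳ (vis ++ F)
                       (∈-mkFrontier⁺ (nextR p F) (vis ++ F) (∈-map⁺ proj₁ (∈-nextR⁺ p F w∈F pw≢w)) pw∉)

-- Phase II of Bulk-Find

module _ (R : List (Pair n)) where

  ∈-allFrom⁺ : (v , just u) ∈ R → just u ∈ allFrom R v
  ∈-allFrom⁺ {v = v} e∈R = ∈-map⁺ proj₂ (∈-filter⁺ (λ e → proj₁ e ≟ v) e∈R refl)

  ∈-allFrom⁻ : just u ∈ allFrom R v → (v , just u) ∈ R
  ∈-allFrom⁻ {v = v} u∈ with ∈-map⁻ proj₂ u∈
  ... | _ , e∈ , refl with ∈-filter⁻ (λ e → proj₁ e ≟ v) e∈
  ...   | e∈R , refl = e∈R

  private
    children : Fin n × Fin n → List (Fin n × Fin n)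
    children (v , r) = map (λ u → (u , r)) (mapMaybe id (allFrom R v))

  ∈-nextD⁺ : ∀ {D} → (v , r) ∈ D → (v , just u) ∈ R → (u , r) ∈ nextD R D
  ∈-nextD⁺ {r = r} vr∈D e∈R =
    ∈-concatMap⁺ children
      (lose vr∈D (∈-map⁺ (λ u → (u , r)) (∈-mapMaybe⁺ id (∈-allFrom⁺ e∈R) refl)))

  ∈-nextD⁻ : ∀ {D} → (u , r) ∈ nextD R D → ∃ λ v → (v , r) ∈ D × (v , just u) ∈ R
  ∈-nextD⁻ {D = D} ur∈ with find-∈ (∈-concatMap⁻ children {xs = D} ur∈)
  ... | (v , r) , vr∈D , ur∈′ with ∈-map⁻ (λ u → (u , r)) ur∈′
  ...   | _ , u∈ , refl with ∈-mapMaybe⁻ id (allFrom R v) u∈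
  ...     | _ , m∈ , refl = v , vr∈D , ∈-allFrom⁻ m∈

Descends : List (Pair n) → Fin n → Fin n → Set
Descends R = Star (λ x y → (x , just y) ∈ R)

module _ {p : Parent n} {S : List (Fin n)} {R : List (Pair n)} (edges : ValidEdges p S R) where

  RootedAncestor : Fin n → Fin n → Set
  RootedAncestor w r = Root p w r × Ancestor p S w

  SoundWrites : List (Fin n × Fin n) → Set
  SoundWrites D = ∀ {v r} → (v , r) ∈ D → RootedAncestor v r

  nextD-sound : ∀ {D} → SoundWrites D → SoundWrites (nextD R D)
  nextD-sound sound ur∈ with ∈-nextD⁻ R ur∈
  ... | _ , vr∈D , e∈R with edges e∈R
  ...   | (pu≢u , refl) , a = map₁ ((pu≢u , refl) ◅_) (proj₁ (sound vr∈D)) , a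

  applyWrites-sound : ∀ q D → SoundWrites D →
                      ∀ w → applyWrites q D w ≡ q w ⊎ RootedAncestor w (applyWrites q D w)
  applyWrites-sound q [] _ w = inj₁ refl
  applyWrites-sound q ((v , r) ∷ D) sound w with applyWrites-sound (q [ v ↦ r ]) D (sound ∘ there) w
  ... | inj₂ rooted = inj₂ rooted
  ... | inj₁ written with w ≟ v
  ...   | yes refl = inj₂ (subst (RootedAncestor w) (sym written) (sound (here refl)))
  ...   | no _ = inj₁ written

  applyWrites-hit : ∀ q D {w r} → (w , r) ∈ D → SoundWrites D → RootedAncestor w (applyWrites q D w)
  applyWrites-hit q ((v , r) ∷ D) {w} (here refl) sound
    with applyWrites-sound (q [ v ↦ r ]) D (sound ∘ there) w
  ... | inj₂ rooted = rooted
  ... | inj₁ written = subst (RootedAncestor w) (sym (trans written ([↦]-same q))) (sound (here refl))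
  applyWrites-hit q ((v , r) ∷ D) (there wr∈D) sound = applyWrites-hit (q [ v ↦ r ]) D wr∈D (sound ∘ there)

  phase2-sound : ∀ {q D q′} → Phase2 R q D q′ → SoundWrites D →
                 ∀ w → q′ w ≡ q w ⊎ RootedAncestor w (q′ w)
  phase2-sound done _ w = inj₁ refl
  phase2-sound {q} {D} (loop run) sound w with phase2-sound run (nextD-sound sound) w
  ... | inj₂ rooted = inj₂ rooted
  ... | inj₁ q′w≡ with applyWrites-sound q D sound w
  ...   | inj₁ written = inj₁ (trans q′w≡ written)
  ...   | inj₂ rooted = inj₂ (subst (RootedAncestor w) (sym q′w≡) rooted)

  phase2-complete : ∀ {q D q′ x r w} → Phase2 R q D q′ → SoundWrites D → (x , r) ∈ D →
                    Descends R x w → RootedAncestor w (q′ w)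
  phase2-complete {q} {D} {w = w} (loop run) sound xr∈D ε with phase2-sound run (nextD-sound sound) w
  ... | inj₂ rooted = rooted
  ... | inj₁ q′w≡ = subst (RootedAncestor w) (sym q′w≡) (applyWrites-hit q D xr∈D sound)
  phase2-complete (loop run) sound xr∈D (e∈R ◅ C) =
    phase2-complete run (nextD-sound sound) (∈-nextD⁺ R xr∈D e∈R) C

targets : List (Pair n) → List (Fin n)
targets = mapMaybe proj₂

module _ {p : Parent n} {S : List (Fin n)} {Rcup : List (Pair n)} {p′ : Parent n} {res : List (Fin n)}
         (bulk : BulkFind p S Rcup p′ res) where

  open BulkFind bulk

  private
    queries-R₀ : map proj₁ (R₀ S) ≡ S
    queries-R₀ = trans (sym (map-∘ S)) (map-id S)

    no-edges-R₀ : ValidEdges p S (R₀ S)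
    no-edges-R₀ e∈ with ∈-map⁻ (λ v → (v , nothing)) e∈
    ... | _ , _ , ()

    frontier-R₀ : ∀ {v} → v ∈ mkFrontier (R₀ S) [] → v ∈ S
    frontier-R₀ v∈ = subst (_ ∈_) queries-R₀ (proj₁ (∈-mkFrontier⁻ (R₀ S) [] v∈))

  bulkFind-valid : ValidEdges p S Rcup × ValidRoots p S roots
  bulkFind-valid = phase1-sound phase1 no-edges-R₀ (λ ()) (Any.map (λ { refl → ε }) ∘ frontier-R₀)

  bulkFind-recorded : Ancestor p S w → Recorded p Rcup roots w
  bulkFind-recorded = phase1-complete phase1 (λ ()) covers (proj₁ ∘ ∈-mkFrontier⁻ (R₀ S) [])
    where
    covers : ∀ {s} → s ∈ S → s ∈ mkFrontier (R₀ S) []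
    covers s∈S = ∈-mkFrontier⁺ (R₀ S) [] (subst (_ ∈_) (sym queries-R₀) s∈S) λ ()

  bulkFind-targets : Ancestor p S w → p w ≢ w → w ∈ targets Rcup
  bulkFind-targets a pw≢w = ∈-mapMaybe⁺ proj₂ (proj₂ (bulkFind-recorded a) pw≢w) refl

  bulkFind-length : length S ≤ length Rcup
  bulkFind-length = subst (_≤ length Rcup) (length-map (λ v → (v , nothing {A = Fin _})) S) (phase1-length phase1)

  descends-from-root : Ancestor p S w → Path p w r → Descends Rcup r w
  descends-from-root a ε = ε
  descends-from-root a ((pw≢w , refl) ◅ P) =
    descends-from-root (Any.map (_◅◅ (pw≢w , refl) ◅ ε) a) P ◅◅ proj₂ (bulkFind-recorded a) pw≢w ◅ ε

  bulkFind-pathCompressed : Total p → PathCompressed p S p′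
  bulkFind-pathCompressed total = record
    { sound = phase2-sound edges phase2 roots-sound
    ; complete = complete′
    }
    where
    edges = proj₁ bulkFind-valid

    roots-sound : SoundWrites edges (map (λ r → (r , r)) roots)
    roots-sound rr∈ with ∈-map⁻ (λ r → (r , r)) rr∈
    ... | _ , r∈ , refl = let r-root , a = proj₂ bulkFind-valid r∈ in (ε , r-root) , a

    complete′ : ∀ {w} → Ancestor p S w → Root p w (p′ w)
    complete′ {w} a with total w
    ... | r , P , r-root = proj₁ (phase2-complete edges phase2 roots-sound r∈D₀ (descends-from-root a P))
      where r∈D₀ = ∈-map⁺ (λ r → (r , r)) (proj₁ (bulkFind-recorded (Any.map (_◅◅ P) a)) r-root)

bulkFind-serialisable : Total p → ∀ {S Rcup p′ res} → BulkFind p S Rcup p′ res →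
                        ∃[ p″ ] ∃[ cost ] (FindSeq p S p″ cost × (∀ v → p″ v ≡ p′ v) ×
                                           cost ≤ 2 * length Rcup)
bulkFind-serialisable {p = p} total {S} {Rcup} bulk
  with findSeq-pathCompressed total {L = targets Rcup} pathCompressed-[] S (bulkFind-targets bulk)
... | p″ , cost , finds , compressed , amortised =
  p″ , cost , finds , pathCompressed-unique compressed (bulkFind-pathCompressed bulk total) , (begin
    cost                                      ≤⟨ m≤m+n cost _ ⟩
    cost + potential p (targets Rcup) p″      ≤⟨ amortised ⟩
    potential p (targets Rcup) p + length S   ≤⟨ +-mono-≤ potential≤ (bulkFind-length bulk) ⟩
    length Rcup + length Rcup                 ≡⟨ cong (length Rcup +_) (sym (+-identityʳ _)) ⟩
    2 * length Rcup                           ∎)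
  where
  open ≤-Reasoning
  potential≤ = ≤-trans (length-filter _ (targets Rcup)) (length-mapMaybe proj₂ Rcup)

lemma8 : ∃[ c ] (∀ {n} (p : Parent n) (s : Fin n → ℕ) → UBS p s →
           (S : List (Fin n)) (Rcup : List (Pair n)) (p' : Parent n)
           (res : List (Fin n)) → BulkFind p S Rcup p' res →
           ∃[ S' ] (S' ↭ S × ∃[ p'' ] ∃[ cost ]
             (FindSeq p S' p'' cost × (∀ v → p'' v ≡ p' v) ×
              cost ≤ c * length Rcup)))
lemma8 = 2 , λ p _ ubs S _ _ _ bulk → S , ↭-refl , bulkFind-serialisable (UBS⇒Total ubs) bulk
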